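{- Let $IP$ be a mixed-integer linear program and $\mathtt{cert}$ a VIPR certificate for $IP$, with notation as in the context. Then $\mathtt{cert}$ is DER-valid if and only if $\phi_{DER}=\mathtt{true}$.
   Context: $IP$ has variables $x\in\mathbb{R}^n$, integer index set $I\subseteq[n]$, objective $c\in\mathbb{R}^n$, sense $\mathtt{min}$ or $\mathtt{max}$, constraints $C_1,\dots,C_m$. A constraint $C$ has coefficients $a\in\mathbb{R}^n$, rhs $b$, sign $s(C)\in\{ -1,0,1\}$ (meaning $a\cdot x\le b$, $=b$, $\ge b$ respectively); for $C_i$ write $a_{i,j},b_i$. A VIPR certificate consists of $RTP$ (either $\mathtt{infeasible}$ or $(lb,ub)$ with $lb\in\mathbb{R}\cup\{ -\infty\}$, $ub\in\mathbb{R}\cup\{\infty\}$), a finite $SOL\subseteq\mathbb{R}^n$, and derived constraints $C_{m+1},\dots,C_d$, each with reason in $\{\mathtt{asm},\mathtt{lin},\mathtt{rnd},\mathtt{uns},\mathtt{sol}\}$, data, and assumption set $\mathtt{A}(C_k)\subseteq S=\{i\in\{m+1,\dots,d\}:\mathtt{reason}(C_i)=\mathtt{asm}\}$; $\mathtt{A}(C_i)=\emptyset$ for $i\le m$. For $\mathtt{lin}/\mathtt{rnd}$, data is $\lambda=\mathtt{data}(C_k)\in\mathbb{R}^d$ with support $\mathtt{nz}(\mathtt{data}(C_k))$; for $\mathtt{uns}$, data is $(i_1,l_1,i_2,l_2)\in[d]^4$. Domination: a constraint $(a,b,s)$ is an absurdity if $a=0$ and ($s=0,b\ne0$) or ($s=1,b>0$)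 or ($s=-1,b<0$); it dominates $(a',b',s')$ if it is an absurdity, or $a=a'$ and [$s'=0\Rightarrow s=0,b=b'$], [$s'=1\Rightarrow s\in\{0,1\},b\ge b'$], [$s'=-1\Rightarrow s\in\{0,-1\},b\le b'$]. The combination $\sum_{i\in N}\lambda_iC_i$ ($N$ the support of $\lambda$) has coefficients $\sum\lambda_ia_i$, rhs $\sum\lambda_ib_i$, and sign $0$ if all $\lambda_is(C_i)=0$, else $1$ if all $\lambda_is(C_i)\ge0$, else $-1$ if all $\le0$, else undefined (then it dominates nothing). Roundable: sign $\pm1$, integer coefficients on $I$, zero off $I$; rounding replaces $b$ by $\lceil b\rceil$ (sign $1$) or $\lfloor b\rfloor$ (sign $-1$). Split disjunction $C_i,C_j$: equal coefficient vectors, integer on $I$ and zero off $I$, $b_i,b_j\in\mathbb{Z}$, nonzero opposite signs, $b_i=b_j+1$ if $s(C_i)=1$ and $b_i=b_j-1$ if $s(C_i)=-1$. Derived constraint $C_k$ valid: ($\mathtt{asm}$) $\mathtt{A}(C_k)=\{k\}$; ($\mathtt{lin}$) $\mathtt{nz}(\lambda)\subseteq[k-1]$, $\mathtt{A}(C_k)=\bigcup_{i\in\mathtt{nz}(\lambda)}\mathtt{A}(C_i)$, and $\sum\lambda_iC_i$ dominates $C_k$; ($\mathtt{rnd}$) same but the combination is roundable and its rounding dominates $C_k$; ($\mathtt{uns}$) $i_1,l_1,i_2,l_2<k$, $C_{i_1},C_{i_2}$ dominate $C_k$, $C_{l_1},C_{l_2}$ form a split disjunction, $\mathtt{A}(C_k)=(\mathtt{A}(C_{i_1})\setminus\{l_1\})\cup(\mathtt{A}(C_{i_2})\setminus\{l_2\})$;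 ($\mathtt{sol}$) $\mathtt{A}(C_k)=\emptyset$ and for some $sol\in SOL$, $c\cdot x\le c\cdot sol$ (min) resp. $c\cdot x\ge c\cdot sol$ (max) dominates $C_k$. $\mathtt{cert}$ is DER-valid if all derived constraints are valid and: if $RTP=\mathtt{infeasible}$, $C_d$ dominates $0\cdot x\ge1$ and $\mathtt{A}(C_d)=\emptyset$; otherwise, if min and $lb\ne-\infty$, $C_d$ dominates $c\cdot x\ge lb$ and $\mathtt{A}(C_d)=\emptyset$; if max and $ub\ne\infty$, $C_d$ dominates $c\cdot x\le ub$ and $\mathtt{A}(C_d)=\emptyset$. Predicates: $P=[\text{sense}=\mathtt{min}]$, $R=[RTP\ne\mathtt{infeasible}]$, $PUB=R\wedge ub\ne\infty$, $PLB=R\wedge lb\ne-\infty$, $U=ub$ if $PUB$ else $0$, $L=lb$ if $PLB$ else $0$; $A_k^j=[j\in\mathtt{A}(C_k)]$; $S_{<k},S_{>k}$ the elements of $S$ below/above $k$. $\phi_{DOM}(a,b,eq,geq,leq,a',b',eq',geq',leq')=[a=0\wedge(\text{if }eq\text{ then }b\ne0\text{ else if }geq\text{ then }b>0\text{ else if }leq\text{ then }b<0\text{ else false})]\vee[a=a'\wedge(\text{if }eq'\text{ then }(eq\wedge b=b')\text{ else if }geq'\text{ then }(geq\wedge b\ge b')\text{ else if }leq'\text{ then }(leq\wedge b\le b')\text{ else false})]$; $\phi_{DOM}(C,C')$ uses $eq=(s(C)=0)$, $geq=(s(C)\ge0)$, $leq=(s(C)\le0)$ and similarly for $C'$. $\phi_{ASM}(k)=\bigwedge_{j\in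 S_{>k}}\neg A_k^j\wedge X$ where $X$ is: ($\mathtt{asm}$) $A_k^k\wedge\bigwedge_{j\in S_{<k}}\neg A_k^j$; ($\mathtt{lin},\mathtt{rnd}$) $\bigwedge_{j\in S_{<k}}(A_k^j=\bigvee_{i\in\mathtt{nz}(\lambda),j\le i<k}A_i^j)$; ($\mathtt{uns}$) $\bigwedge_{j\in S_{<k}}(A_k^j=(A_{i_1}^j\wedge j\ne l_1)\vee(A_{i_2}^j\wedge j\ne l_2))$; ($\mathtt{sol}$) $\bigwedge_{j\in S_{<k}}\neg A_k^j$. $\phi_{PRV}(k)=\bigwedge_{j\in\mathtt{nz}(\lambda)}(j<k)$. $\phi_{RND}(a,b,eq)=\bigwedge_{j\in I}(a_j\in\mathbb{Z})\wedge\bigwedge_{j\notin I}(a_j=0)\wedge\neg eq$. $\phi_{DIS}(i,j)$ = equal coefficient vectors of $C_i,C_j$, integer on $I$, zero off $I$, $b_i,b_j\in\mathbb{Z}$, $s(C_i)\ne0\wedge s(C_i)+s(C_j)=0$, and (if $s(C_i)=1$ then $b_i=b_j+1$ else $b_i=b_j-1$). For $\mathtt{lin}/\mathtt{rnd}$ with $N=\mathtt{nz}(\lambda)$: $eq=\bigwedge_N(\lambda_is(C_i)=0)$, $geq=\bigwedge_N(\lambda_is(C_i)\ge0)$, $leq=\bigwedge_N(\lambda_is(C_i)\le0)$, $A=\sum_N\lambda_ia_i$, $B=\sum_N\lambda_ib_i$. $\phi_{DER}(k)$: ($\mathtt{asm}$) $\phi_{ASM}(k)$; ($\mathtt{lin}$)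 $\phi_{ASM}(k)\wedge\phi_{PRV}(k)\wedge\phi_{DOM}(A,B,eq,geq,leq,a_k,b_k,s(C_k)=0,s(C_k)\ge0,s(C_k)\le0)$; ($\mathtt{rnd}$) $\phi_{ASM}(k)\wedge\phi_{PRV}(k)\wedge\phi_{RND}(A,B,eq)\wedge([A=0\wedge(\text{if }geq\text{ then }B>0\text{ else if }leq\text{ then }B<0\text{ else false})]\vee[A=a_k\wedge(\text{if }s(C_k)=0\text{ then false else if }s(C_k)=1\text{ then }(geq\wedge\lceil B\rceil\ge b_k)\text{ else }(leq\wedge\lfloor B\rfloor\le b_k))])$; ($\mathtt{uns}$) $\phi_{ASM}(k)\wedge k>i_1\wedge k>i_2\wedge k>l_1\wedge k>l_2\wedge\phi_{DOM}(C_{i_1},C_k)\wedge\phi_{DOM}(C_{i_2},C_k)\wedge\phi_{DIS}(l_1,l_2)$; ($\mathtt{sol}$) $\phi_{ASM}(k)\wedge$ (if $P$ then $\bigvee_{sol}\phi_{DOM}(c\cdot x\le c\cdot sol,C_k)$ else $\bigvee_{sol}\phi_{DOM}(c\cdot x\ge c\cdot sol,C_k)$). Finally $\phi_{DER}=\bigwedge_{m<k\le d}\phi_{DER}(k)\wedge$ (if $\neg R$ then $\phi_{DOM}(C_d,0\cdot x\ge1)\wedge\bigwedge_{j\in S}\neg A_d^j$ else $[(P\wedge PLB)\Rightarrow(\phi_{DOM}(C_d,c\cdot x\ge L)\wedge\bigwedge_{j\in S}\neg A_d^j)]\wedge[(\neg P\wedge PUB)\Rightarrow(\phi_{DOM}(C_d,c\cdot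 x\le U)\wedge\bigwedge_{j\in S}\neg A_d^j)]$).
   Formalization: All numeric data of the program and certificate (coefficients $a$, right-hand sides $b$, objective $c$, multipliers $\lambda$, points of $SOL$, bounds $lb$ and $ub$) are rational rather than real. -}

module Defs where

open import Data.Bool using (Bool; true; false; _∧_; _∨_; not; if_then_else_; T)
open import Data.Nat as ℕ using (ℕ; zero; suc)
open import Data.Fin as Fin using (Fin; toℕ; splitAt; _↑ʳ_)
open import Data.Integer as ℤ using (ℤ)
import Data.Integer.Properties as ℤP
open import Data.Rational as ℚ using (ℚ; 0ℚ; 1ℚ; floor; ceiling)
import Data.Rational.Properties as ℚP
open import Data.Maybe using (Maybe; just; nothing)
open import Data.List using (List)
open import Data.List.Relation.Unary.Any using (Any)
open import Data.Product using (Σ; _×_; _,_; ∃)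
open import Data.Sum using (_⊎_; inj₁; inj₂)
open import Data.Empty using (⊥)
open import Data.Unit using (⊤)
open import Relation.Binary.PropositionalEquality using (_≡_; _≢_)
open import Relation.Nullary using (¬_; does)
open import Function.Bundles using (_⇔_)

-- the three constraint senses: leq ↔ s = -1 (a·x ≤ b), eq ↔ s = 0, geq ↔ s = 1
data Sign : Set where
  leq eq geq : Sign

sgnℤ : Sign → ℤ
sgnℤ leq = ℤ.- (ℤ.+ 1)
sgnℤ eq  = ℤ.+ 0
sgnℤ geq = ℤ.+ 1

ι : ℤ → ℚ
ι z = z ℚ./ 1

sgnℚ : Sign → ℚ
sgnℚ s = ι (sgnℤ s)

record Constraint (n : ℕ) : Set where
  constructor mkCons
  field
    coef : Fin n → ℚ
    rhs  : ℚ
    sign : Sign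
open Constraint public

data Sense : Set where
  min max : Sense

record MILP : Set where
  field
    n      : ℕ
    intVar : Fin n → Bool
    obj    : Fin n → ℚ
    sense  : Sense
    m      : ℕ
    cons   : Fin m → Constraint n
open MILP public

-- relation to prove: lb = nothing means -∞, ub = nothing means +∞
data RTP : Set where
  infeasible : RTP
  bounds     : (lb : Maybe ℚ) (ub : Maybe ℚ) → RTP

-- reasons with data; indices range over all d constraints (0-based)
data Reason (d : ℕ) : Set where
  asm : Reason d
  lin : (Fin d → ℚ) → Reason d
  rnd : (Fin d → ℚ) → Reason d
  uns : (i₁ l₁ i₂ l₂ : Fin d) → Reason d
  sol : Reason d

isAsmR : ∀ {d} → Reason d → Bool
isAsmR asm = true
isAsmR _   = false

-- The constraints are indexed 0 … d-1 with d = m + nder;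
-- indices < m are the constraints of the IP, the others are derived.
-- Assumption sets are given as characteristic functions on Fin d and are
-- required to be subsets of S (the indices of assumptions).
-- j ∈ S, computed from the reasons (original constraints are never assumptions)
isAsmAt : ∀ m {nd} → (Fin nd → Reason (m ℕ.+ nd)) → Fin (m ℕ.+ nd) → Bool
isAsmAt m r k with splitAt m k
... | inj₁ _ = false
... | inj₂ i = isAsmR (r i)

record Certificate (ip : MILP) : Set where
  field
    rtp     : RTP
    SOL     : List (Fin (n ip) → ℚ)
    nder    : ℕ
    derived : Fin nder → Constraint (n ip)
    reason  : Fin nder → Reason (m ip ℕ.+ nder)
    asmSet  : Fin nder → Fin (m ip ℕ.+ nder) → Bool
    asm⊆S   : ∀ (k : Fin nder) (j : Fin (m ip ℕ.+ nder)) →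
              T (asmSet k j) → T (isAsmAt (m ip) reason j)
open Certificate public

module _ {ip : MILP} (cert : Certificate ip) where
  d : ℕ
  d = m ip ℕ.+ nder cert

  C : Fin d → Constraint (n ip)
  C k with splitAt (m ip) k
  ... | inj₁ i = cons ip i
  ... | inj₂ i = derived cert i

  isAsm : Fin d → Bool
  isAsm = isAsmAt (m ip) (reason cert)

  -- A_k^j = [ j ∈ A(C_k) ], with A(C_i) = ∅ for original constraints
  A : Fin d → Fin d → Bool
  A k j with splitAt (m ip) k
  ... | inj₁ _ = false
  ... | inj₂ i = asmSet cert i j

sumFin : ∀ {k} → (Fin k → ℚ) → ℚ
sumFin {zero}  f = 0ℚ
sumFin {suc k} f = f Fin.zero ℚ.+ sumFin (λ i → f (Fin.suc i))

allFin : ∀ {k} → (Fin k → Bool) → Bool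
allFin {zero}  f = true
allFin {suc k} f = f Fin.zero ∧ allFin (λ i → f (Fin.suc i))

anyFin : ∀ {k} → (Fin k → Bool) → Bool
anyFin {zero}  f = false
anyFin {suc k} f = f Fin.zero ∨ anyFin (λ i → f (Fin.suc i))

anyList : ∀ {A : Set} → (A → Bool) → List A → Bool
anyList p List.[] = false
anyList p (x List.∷ xs) = p x ∨ anyList p xs

infix 4 _=ℚ_ _≤ℚ_ _<ℚ_ _=ℤ_ _≤ℤ_ _<F_ _≤F_ _=F_ _==ᵇ_
infixr 1 _⇒ᵇ_

_==ᵇ_ : Bool → Bool → Bool
true  ==ᵇ b = b
false ==ᵇ b = not b

_⇒ᵇ_ : Bool → Bool → Bool
a ⇒ᵇ b = not a ∨ b

_=ℚ_ : ℚ → ℚ → Bool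
p =ℚ q = does (p ℚP.≟ q)

_≤ℚ_ : ℚ → ℚ → Bool
p ≤ℚ q = does (p ℚP.≤? q)

_<ℚ_ : ℚ → ℚ → Bool
p <ℚ q = does (p ℚP.<? q)

_=ℤ_ : ℤ → ℤ → Bool
p =ℤ q = does (p ℤ.≟ q)

_≤ℤ_ : ℤ → ℤ → Bool
p ≤ℤ q = does (p ℤ.≤? q)

_<F_ : ∀ {k} → Fin k → Fin k → Bool
i <F j = does (toℕ i ℕ.<? toℕ j)

_≤F_ : ∀ {k} → Fin k → Fin k → Bool
i ≤F j = does (toℕ i ℕ.≤? toℕ j)

_=F_ : ∀ {k} → Fin k → Fin k → Bool
i =F j = does (i Fin.≟ j)

IsInt : ℚ → Set
IsInt q = Σ ℤ (λ z → q ≡ ι z)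

isIntᵇ : ℚ → Bool
isIntᵇ q = ι (floor q) =ℚ q

lastIdx : ∀ k → Maybe (Fin k)
lastIdx zero    = nothing
lastIdx (suc k) = just (Fin.fromℕ k)

dot : ∀ {n} → (Fin n → ℚ) → (Fin n → ℚ) → ℚ
dot a x = sumFin (λ j → a j ℚ.* x j)

zeroVec : ∀ {n} → Fin n → ℚ
zeroVec _ = 0ℚ

falseCons : ∀ {n} → Constraint n
falseCons = mkCons zeroVec 1ℚ geq

Absurdity : ∀ {n} → Constraint n → Set
Absurdity (mkCons a b s) = (∀ j → a j ≡ 0ℚ) × AbsRhs s
  where
  AbsRhs : Sign → Set
  AbsRhs eq  = b ≢ 0ℚ
  AbsRhs geq = 0ℚ ℚ.< b
  AbsRhs leq = b ℚ.< 0ℚ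

Dominates : ∀ {n} → Constraint n → Constraint n → Set
Dominates C C' = Absurdity C ⊎ ((∀ j → coef C j ≡ coef C' j) × SignDom (sign C') )
  where
  SignDom : Sign → Set
  SignDom eq  = sign C ≡ eq × rhs C ≡ rhs C'
  SignDom geq = (sign C ≡ eq ⊎ sign C ≡ geq) × rhs C' ℚ.≤ rhs C
  SignDom leq = (sign C ≡ eq ⊎ sign C ≡ leq) × rhs C ℚ.≤ rhs C'

-- "nothing" dominates nothing (undefined combination)
DominatesM : ∀ {n} → Maybe (Constraint n) → Constraint n → Set
DominatesM nothing  C' = ⊥
DominatesM (just C) C' = Dominates C C'

module _ {n d : ℕ} (C : Fin d → Constraint n) (λ' : Fin d → ℚ) where
  nzᵇ : Fin d → Bool
  nzᵇ i = not (λ' i =ℚ 0ℚ)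

  combCoef : Fin n → ℚ
  combCoef j = sumFin (λ i → if nzᵇ i then λ' i ℚ.* coef (C i) j else 0ℚ)

  combRhs : ℚ
  combRhs = sumFin (λ i → if nzᵇ i then λ' i ℚ.* rhs (C i) else 0ℚ)

  combEq combGeq combLeq : Bool
  combEq  = allFin (λ i → nzᵇ i ⇒ᵇ ((λ' i ℚ.* sgnℚ (sign (C i))) =ℚ 0ℚ))
  combGeq = allFin (λ i → nzᵇ i ⇒ᵇ (0ℚ ≤ℚ (λ' i ℚ.* sgnℚ (sign (C i)))))
  combLeq = allFin (λ i → nzᵇ i ⇒ᵇ ((λ' i ℚ.* sgnℚ (sign (C i))) ≤ℚ 0ℚ))

  combination : Maybe (Constraint n)
  combination =
    if combEq then just (mkCons combCoef combRhs eq)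
    else if combGeq then just (mkCons combCoef combRhs geq)
    else if combLeq then just (mkCons combCoef combRhs leq)
    else nothing

module _ {n : ℕ} (I : Fin n → Bool) where
  IntOnIZeroOff : (Fin n → ℚ) → Set
  IntOnIZeroOff a = ∀ j → (T (I j) → IsInt (a j)) × (¬ T (I j) → a j ≡ 0ℚ)

  Roundable : Constraint n → Set
  Roundable C = sign C ≢ eq × IntOnIZeroOff (coef C)

  rounding : Constraint n → Constraint n
  rounding (mkCons a b geq) = mkCons a (ι (ceiling b)) geq
  rounding (mkCons a b leq) = mkCons a (ι (floor b)) leq
  rounding (mkCons a b eq)  = mkCons a b eq

  SplitDisj : Constraint n → Constraint n → Set
  SplitDisj Ci Cj =
    (∀ k → coef Ci k ≡ coef Cj k) × IntOnIZeroOff (coef Ci)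
    × IsInt (rhs Ci) × IsInt (rhs Cj)
    × ((sign Ci ≡ geq × sign Cj ≡ leq × rhs Ci ≡ rhs Cj ℚ.+ 1ℚ)
       ⊎ (sign Ci ≡ leq × sign Cj ≡ geq × rhs Ci ≡ rhs Cj ℚ.- 1ℚ))

solCons : (ip : MILP) → (Fin (n ip) → ℚ) → Constraint (n ip)
solCons ip s with sense ip
... | min = mkCons (obj ip) (dot (obj ip) s) leq
... | max = mkCons (obj ip) (dot (obj ip) s) geq

module _ (ip : MILP) (cert : Certificate ip) where
  private
    D = d cert
    Cc = C cert
    Ac = A cert

  _<ᶠ_ : Fin D → Fin D → Set
  i <ᶠ j = toℕ i ℕ.< toℕ j

  ValidReason : Fin D → Reason D → Set
  ValidReason k asm = ∀ j → Ac k j ≡ (j =F k)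
  ValidReason k (lin λ') =
    (∀ i → λ' i ≢ 0ℚ → i <ᶠ k)
    × (∀ j → T (Ac k j) ⇔ ∃ (λ i → λ' i ≢ 0ℚ × T (Ac i j)))
    × DominatesM (combination Cc λ') (Cc k)
  ValidReason k (rnd λ') =
    (∀ i → λ' i ≢ 0ℚ → i <ᶠ k)
    × (∀ j → T (Ac k j) ⇔ ∃ (λ i → λ' i ≢ 0ℚ × T (Ac i j)))
    × RndOK (combination Cc λ')
    where
    RndOK : Maybe (Constraint (n ip)) → Set
    RndOK nothing   = ⊥
    RndOK (just C') = Roundable (intVar ip) C' × Dominates (rounding (intVar ip) C') (Cc k)
  ValidReason k (uns i₁ l₁ i₂ l₂) =
    i₁ <ᶠ k × l₁ <ᶠ k × i₂ <ᶠ k × l₂ <ᶠ k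
    × Dominates (Cc i₁) (Cc k) × Dominates (Cc i₂) (Cc k)
    × SplitDisj (intVar ip) (Cc l₁) (Cc l₂)
    × (∀ j → T (Ac k j) ⇔ ((T (Ac i₁ j) × j ≢ l₁) ⊎ (T (Ac i₂ j) × j ≢ l₂)))
  ValidReason k sol =
    (∀ j → ¬ T (Ac k j))
    × Any (λ s → Dominates (solCons ip s) (Cc k)) (SOL cert)

  LastOK : Constraint (n ip) → Set
  LastOK Q with lastIdx D
  ... | nothing = ⊥
  ... | just l  = Dominates (Cc l) Q × (∀ j → ¬ T (Ac l j))

  FinalOK : RTP → Sense → Set
  FinalOK infeasible _ = LastOK falseCons
  FinalOK (bounds (just lb) _) min = LastOK (mkCons (obj ip) lb geq)
  FinalOK (bounds nothing   _) min = ⊤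
  FinalOK (bounds _ (just ub)) max = LastOK (mkCons (obj ip) ub leq)
  FinalOK (bounds _ nothing)   max = ⊤

  DERValid : Set
  DERValid =
    (∀ (k : Fin (nder cert)) → ValidReason (m ip ↑ʳ k) (reason cert k))
    × FinalOK (rtp cert) (sense ip)

eqS geqS leqS : Sign → Bool
eqS  s = sgnℤ s =ℤ ℤ.+ 0
geqS s = ℤ.+ 0 ≤ℤ sgnℤ s
leqS s = sgnℤ s ≤ℤ ℤ.+ 0

module _ {n : ℕ} where

  vecEqᵇ : (Fin n → ℚ) → (Fin n → ℚ) → Bool
  vecEqᵇ a a' = allFin (λ j → a j =ℚ a' j)

  φDOM : (a : Fin n → ℚ) (b : ℚ) (eq' geq' leq' : Bool)
         (a₂ : Fin n → ℚ) (b₂ : ℚ) (eq₂ geq₂ leq₂ : Bool) → Bool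
  φDOM a b e g l a₂ b₂ e₂ g₂ l₂ =
    (vecEqᵇ a zeroVec ∧
      (if e then not (b =ℚ 0ℚ) else if g then 0ℚ <ℚ b else if l then b <ℚ 0ℚ else false))
    ∨ (vecEqᵇ a a₂ ∧
      (if e₂ then (e ∧ (b =ℚ b₂)) else if g₂ then (g ∧ (b₂ ≤ℚ b))
       else if l₂ then (l ∧ (b ≤ℚ b₂)) else false))

  φDOMᶜ : Constraint n → Constraint n → Bool
  φDOMᶜ C C' = φDOM (coef C) (rhs C) (eqS (sign C)) (geqS (sign C)) (leqS (sign C))
                    (coef C') (rhs C') (eqS (sign C')) (geqS (sign C')) (leqS (sign C'))

  intOnIᵇ : (Fin n → Bool) → (Fin n → ℚ) → Bool
  intOnIᵇ I a = allFin (λ j → if I j then isIntᵇ (a j) else a j =ℚ 0ℚ)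

  φRND : (Fin n → Bool) → (Fin n → ℚ) → ℚ → Bool → Bool
  φRND I a b e = intOnIᵇ I a ∧ not e

module _ (ip : MILP) (cert : Certificate ip) where
  private
    D = d cert
    Cc = C cert
    Ac = A cert
    I = intVar ip

  P R PUB PLB : Bool
  P with sense ip
  ... | min = true
  ... | max = false
  R with rtp cert
  ... | infeasible = false
  ... | bounds _ _ = true
  PUB with rtp cert
  ... | bounds _ (just _) = true
  ... | _ = false
  PLB with rtp cert
  ... | bounds (just _) _ = true
  ... | _ = false

  U L : ℚ
  U with rtp cert
  ... | bounds _ (just ub) = ub
  ... | _ = 0ℚ
  L with rtp cert
  ... | bounds (just lb) _ = lb
  ... | _ = 0ℚ

  allS< allS> : Fin D → (Fin D → Bool) → Bool
  allS< k f = allFin (λ j → (isAsm cert j ∧ (j <F k)) ⇒ᵇ f j)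
  allS> k f = allFin (λ j → (isAsm cert j ∧ (k <F j)) ⇒ᵇ f j)

  φASM : Fin D → Reason D → Bool
  φASM k r = allS> k (λ j → not (Ac k j)) ∧ X r
    where
    X : Reason D → Bool
    X asm = Ac k k ∧ allS< k (λ j → not (Ac k j))
    X (lin λ') = allS< k (λ j → Ac k j ==ᵇ
                   anyFin (λ i → nzᵇ Cc λ' i ∧ (j ≤F i) ∧ (i <F k) ∧ Ac i j))
    X (rnd λ') = allS< k (λ j → Ac k j ==ᵇ
                   anyFin (λ i → nzᵇ Cc λ' i ∧ (j ≤F i) ∧ (i <F k) ∧ Ac i j))
    X (uns i₁ l₁ i₂ l₂) = allS< k (λ j → Ac k j ==ᵇ
                   ((Ac i₁ j ∧ not (j =F l₁)) ∨ (Ac i₂ j ∧ not (j =F l₂))))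
    X sol = allS< k (λ j → not (Ac k j))

  φPRV : Fin D → (Fin D → ℚ) → Bool
  φPRV k λ' = allFin (λ j → nzᵇ Cc λ' j ⇒ᵇ (j <F k))

  φDIS : Fin D → Fin D → Bool
  φDIS i j =
    vecEqᵇ (coef (Cc i)) (coef (Cc j)) ∧ intOnIᵇ I (coef (Cc i))
    ∧ isIntᵇ (rhs (Cc i)) ∧ isIntᵇ (rhs (Cc j))
    ∧ not (sgnℤ (sign (Cc i)) =ℤ ℤ.+ 0)
    ∧ ((sgnℤ (sign (Cc i)) ℤ.+ sgnℤ (sign (Cc j))) =ℤ ℤ.+ 0)
    ∧ (if sgnℤ (sign (Cc i)) =ℤ ℤ.+ 1
       then rhs (Cc i) =ℚ (rhs (Cc j) ℚ.+ 1ℚ)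
       else rhs (Cc i) =ℚ (rhs (Cc j) ℚ.- 1ℚ))

  objLe objGe : (Fin (n ip) → ℚ) → Constraint (n ip)
  objLe s = mkCons (obj ip) (dot (obj ip) s) leq
  objGe s = mkCons (obj ip) (dot (obj ip) s) geq

  φDERₖ : Fin D → Reason D → Bool
  φDERₖ k asm = φASM k asm
  φDERₖ k (lin λ') =
    φASM k (lin λ') ∧ φPRV k λ'
    ∧ φDOM (combCoef Cc λ') (combRhs Cc λ') (combEq Cc λ') (combGeq Cc λ') (combLeq Cc λ')
           (coef (Cc k)) (rhs (Cc k)) (eqS (sign (Cc k))) (geqS (sign (Cc k))) (leqS (sign (Cc k)))
  φDERₖ k (rnd λ') =
    φASM k (rnd λ') ∧ φPRV k λ' ∧ φRND I Aₗ Bₗ (combEq Cc λ')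
    ∧ ((vecEqᵇ Aₗ zeroVec ∧
         (if combGeq Cc λ' then 0ℚ <ℚ Bₗ else if combLeq Cc λ' then Bₗ <ℚ 0ℚ else false))
       ∨ (vecEqᵇ Aₗ (coef (Cc k)) ∧
         (if sgnℤ (sign (Cc k)) =ℤ ℤ.+ 0 then false
          else if sgnℤ (sign (Cc k)) =ℤ ℤ.+ 1
               then (combGeq Cc λ' ∧ (rhs (Cc k) ≤ℚ ι (ceiling Bₗ)))
               else (combLeq Cc λ' ∧ (ι (floor Bₗ) ≤ℚ rhs (Cc k))))))
    where
    Aₗ = combCoef Cc λ'
    Bₗ = combRhs Cc λ'
  φDERₖ k (uns i₁ l₁ i₂ l₂) =
    φASM k (uns i₁ l₁ i₂ l₂) ∧ (i₁ <F k) ∧ (i₂ <F k) ∧ (l₁ <F k) ∧ (l₂ <F k)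
    ∧ φDOMᶜ (Cc i₁) (Cc k) ∧ φDOMᶜ (Cc i₂) (Cc k) ∧ φDIS l₁ l₂
  φDERₖ k sol =
    φASM k sol ∧
    (if P then anyList (λ s → φDOMᶜ (objLe s) (Cc k)) (SOL cert)
          else anyList (λ s → φDOMᶜ (objGe s) (Cc k)) (SOL cert))

  lastᵇ : Constraint (n ip) → Bool
  lastᵇ Q with lastIdx D
  ... | nothing = false
  ... | just l  = φDOMᶜ (Cc l) Q ∧ allFin (λ j → isAsm cert j ⇒ᵇ not (Ac l j))

  φDER : Bool
  φDER =
    allFin (λ (k : Fin (nder cert)) → φDERₖ (m ip ↑ʳ k) (reason cert k))
    ∧ (if not R then lastᵇ falseCons
       else (((P ∧ PLB) ⇒ᵇ lastᵇ (mkCons (obj ip) L geq))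
             ∧ ((not P ∧ PUB) ⇒ᵇ lastᵇ (mkCons (obj ip) U leq))))

{-# OPTIONS --safe #-}
module Submission where

-- Each conjunct of φ_DER is the Boolean reflection of the matching clause of DER-validity;
-- they differ on their face in three places.  (1) φ_DER encodes the sign of Σ λᵢ Cᵢ by the
-- flags eq, geq, leq; these always form one of four consistent patterns (SignFlags), on which
-- φ_DOM agrees with domination by the combination.  (2) For rounding, φ_DER tests B > 0
-- (B < 0) where the rounded constraint has ⌈B⌉ > 0 (⌊B⌋ < 0); these are equivalent.
-- (3) φ_ASM only inspects A_k^j for j ∈ S with j ≠ k, and for lin/rnd only predecessors i
-- with j ≤ i < k.  Nothing is lost: A(C_k) ⊆ S, k ∉ S unless C_k is an assumption, and every
-- constraint depends only on assumptions of smaller or equal index.  That last invariant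
-- follows from validity by induction along the certificate, and from φ_DER directly through
-- its conjuncts ¬A_k^j for j > k.

open import Defs
open import Data.Bool using (Bool; true; false; T; not; _∧_; _∨_; if_then_else_)
open import Data.Bool.Properties using (T-≡; T-not-≡; T-∧; T-∨; ∧-zeroʳ)
open import Data.Empty using (⊥; ⊥-elim)
open import Data.Fin as Fin using (Fin; _<_; _≤_; splitAt; _↑ʳ_)
import Data.Fin.Induction as FinInd
import Data.Fin.Properties as FinP
open import Data.Integer as ℤ using (+_; -[1+_]; 0ℤ)
import Data.Integer.DivMod as ℤD
import Data.Integer.Properties as ℤP
open import Data.List using ([]; _∷_)
open import Data.List.Relation.Unary.Any using (Any; here; there)
open import Data.Maybe using (Maybe; just; nothing)
open import Data.Nat as ℕ using (ℕ; zero; suc)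
import Data.Nat.Coprimality as Coprimality
import Data.Nat.DivMod as ℕD
import Data.Nat.Properties as ℕP
open import Data.Product using (∃; _×_; _,_; proj₁; proj₂; swap)
open import Data.Product.Function.NonDependent.Propositional using (_×-⇔_)
open import Data.Rational as ℚ using (ℚ; mkℚ; 0ℚ; 1ℚ; floor; ceiling; ↥_)
import Data.Rational.Properties as ℚP
open import Data.Sum using (_⊎_; inj₁; inj₂)
open import Data.Sum.Function.Propositional using (_⊎-⇔_)
open import Data.Unit using (tt)
open import Function using (_∘_)
open import Function.Bundles using (_⇔_; mk⇔; module Equivalence)
open import Function.Construct.Identity using (⇔-id)
open import Function.Construct.Symmetry using (⇔-sym)
open import Function.Properties.Equivalence using () renaming (trans to ⇔-trans)
open import Function.Related.Propositional using (module EquationalReasoning)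
open import Function.Related.TypeIsomorphisms using (¬-cong-⇔; →-cong-⇔; Related-cong)
open import Induction.WellFounded using (Acc; acc)
open import Relation.Binary.Definitions using (tri<; tri≈; tri>)
open import Relation.Binary.PropositionalEquality
  using (_≡_; _≢_; refl; sym; trans; cong; cong₂; subst)
open import Relation.Nullary using (¬_; Dec; does; yes; no)
open import Relation.Nullary.Decidable using (does-⇔; T?; dec-true; dec-false)

open Equivalence using (to; from)

infixr 2 _∧-⇔_
infixr 1 _∨-⇔_

Π-cong-⇔ : ∀ {a p q} {A : Set a} {P : A → Set p} {Q : A → Set q} →
           (∀ x → P x ⇔ Q x) → (∀ x → P x) ⇔ (∀ x → Q x)
Π-cong-⇔ P⇔Q = mk⇔ (λ f x → to (P⇔Q x) (f x)) (λ g x → from (P⇔Q x) (g x))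

∃-cong-⇔ : ∀ {a p q} {A : Set a} {P : A → Set p} {Q : A → Set q} →
           (∀ x → P x ⇔ Q x) → ∃ P ⇔ ∃ Q
∃-cong-⇔ P⇔Q = mk⇔ (λ (x , p) → x , to (P⇔Q x) p) (λ (x , q) → x , from (P⇔Q x) q)

T-does : ∀ {p} {P : Set p} (P? : Dec P) → T (does P?) ⇔ P
T-does (yes p) = mk⇔ (λ _ → p) (λ _ → tt)
T-does (no ¬p) = mk⇔ (λ ()) ¬p

T-not : ∀ {x} → T (not x) ⇔ (¬ T x)
T-not {true}  = mk⇔ (λ ()) (λ ¬⊤ → ¬⊤ tt)
T-not {false} = mk⇔ (λ _ ()) (λ _ → tt)

T-not-does : ∀ {p} {P : Set p} (P? : Dec P) → T (not (does P?)) ⇔ (¬ P)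
T-not-does P? = ⇔-trans T-not (¬-cong-⇔ (T-does P?))

T-⇒ᵇ : ∀ {x y} → T (x ⇒ᵇ y) ⇔ (T x → T y)
T-⇒ᵇ {true}  = mk⇔ (λ y _ → y) (λ f → f tt)
T-⇒ᵇ {false} = mk⇔ (λ _ ()) (λ _ → tt)

T-==ᵇ : ∀ {x y} → T (x ==ᵇ y) ⇔ (T x ⇔ T y)
T-==ᵇ {true}  {true}  = mk⇔ (λ _ → ⇔-id _) (λ _ → tt)
T-==ᵇ {true}  {false} = mk⇔ (λ ()) (λ x⇔y → to x⇔y tt)
T-==ᵇ {false} {true}  = mk⇔ (λ ()) (λ x⇔y → from x⇔y tt)
T-==ᵇ {false} {false} = mk⇔ (λ _ → mk⇔ (λ ()) (λ ())) (λ _ → tt)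

_∧-⇔_ : ∀ {x y} {X Y : Set} → T x ⇔ X → T y ⇔ Y → T (x ∧ y) ⇔ (X × Y)
x⇔X ∧-⇔ y⇔Y = ⇔-trans T-∧ (x⇔X ×-⇔ y⇔Y)

_∨-⇔_ : ∀ {x y} {X Y : Set} → T x ⇔ X → T y ⇔ Y → T (x ∨ y) ⇔ (X ⊎ Y)
x⇔X ∨-⇔ y⇔Y = ⇔-trans T-∨ (x⇔X ⊎-⇔ y⇔Y)

T-∧-dependent : ∀ {x y} {X Y : Set} → T y ⇔ Y → (Y → T x ⇔ X) → T (x ∧ y) ⇔ (X × Y)
T-∧-dependent y⇔Y x⇔X = mk⇔
  (λ t → let (tx , ty) = to T-∧ t ; y = to y⇔Y ty in to (x⇔X y) tx , y)
  (λ (x , y) → from T-∧ (from (x⇔X y) x , from y⇔Y y))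

¬T-∨-∧false : ∀ x y → ¬ T ((x ∧ false) ∨ (y ∧ false))
¬T-∨-∧false x y rewrite ∧-zeroʳ x | ∧-zeroʳ y = λ ()

T-allFin : ∀ {k} (f : Fin k → Bool) → T (allFin f) ⇔ (∀ i → T (f i))
T-allFin {zero}  f = mk⇔ (λ _ ()) (λ _ → tt)
T-allFin {suc k} f = ⇔-trans (⇔-id _ ∧-⇔ T-allFin (f ∘ Fin.suc)) FinP.∀-cons-⇔

T-allFin-⇒ᵇ : ∀ {k} (p q : Fin k → Bool) →
  T (allFin (λ i → p i ⇒ᵇ q i)) ⇔ (∀ i → T (p i) → T (q i))
T-allFin-⇒ᵇ p q = ⇔-trans (T-allFin _) (Π-cong-⇔ (λ i → T-⇒ᵇ))

T-allFin-guarded : ∀ {k} (s r f : Fin k → Bool) {R : Fin k → Set} → (∀ j → T (r j) ⇔ R j) →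
  T (allFin (λ j → (s j ∧ r j) ⇒ᵇ f j)) ⇔ (∀ j → T (s j) → R j → T (f j))
T-allFin-guarded s r f r⇔R = ⇔-trans (T-allFin-⇒ᵇ _ _) (Π-cong-⇔ λ j →
  mk⇔ (λ h sⱼ Rⱼ → h (from T-∧ (sⱼ , from (r⇔R j) Rⱼ)))
      (λ h t → let (sⱼ , rⱼ) = to T-∧ t in h sⱼ (to (r⇔R j) rⱼ)))

T-anyFin : ∀ {k} (f : Fin k → Bool) → T (anyFin f) ⇔ ∃ (λ i → T (f i))
T-anyFin {zero}  f = mk⇔ (λ ()) (λ ())
T-anyFin {suc k} f = ⇔-trans (⇔-id _ ∨-⇔ T-anyFin (f ∘ Fin.suc)) FinP.⊎⇔∃

T-anyList : ∀ {X : Set} {P : X → Set} (p : X → Bool) → (∀ x → T (p x) ⇔ P x) →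
            ∀ xs → T (anyList p xs) ⇔ Any P xs
T-anyList p p⇔P []       = mk⇔ (λ ()) (λ ())
T-anyList p p⇔P (x ∷ xs) = ⇔-trans (p⇔P x ∨-⇔ T-anyList p p⇔P xs)
  (mk⇔ (λ { (inj₁ px) → here px ; (inj₂ pxs) → there pxs })
       (λ { (here px) → inj₁ px ; (there pxs) → inj₂ pxs }))

T-<F : ∀ {k} (i j : Fin k) → T (i <F j) ⇔ i < j
T-<F i j = T-does (Fin.toℕ i ℕ.<? Fin.toℕ j)

T-≤F : ∀ {k} (i j : Fin k) → T (i ≤F j) ⇔ i ≤ j
T-≤F i j = T-does (Fin.toℕ i ℕ.≤? Fin.toℕ j)

∀-by-trichotomy : ∀ {n p} {P : Fin n → Set p} (S : Fin n → Bool) (k : Fin n) →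
  (∀ j → ¬ T (S j) → P j) →
  (∀ j → P j) ⇔ ((∀ j → T (S j) → k < j → P j) × P k × (∀ j → T (S j) → j < k → P j))
∀-by-trichotomy {P = P} S k outside =
  mk⇔ (λ ∀P → (λ j _ _ → ∀P j) , ∀P k , (λ j _ _ → ∀P j)) inside
  where
  inside : (∀ j → T (S j) → k < j → P j) × P k × (∀ j → T (S j) → j < k → P j) → ∀ j → P j
  inside (above , atK , below) j with T? (S j) | FinP.<-cmp j k
  ... | no  j∉S | _             = outside j j∉S
  ... | yes j∈S | tri< j<k _ _  = below j j∈S j<k
  ... | yes _   | tri≈ _ refl _ = atK
  ... | yes j∈S | tri> _ _ k<j  = above j j∈S k<j

T-vecEqᵇ : ∀ {n} (a a' : Fin n → ℚ) → T (vecEqᵇ a a') ⇔ (∀ j → a j ≡ a' j)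
T-vecEqᵇ a a' = ⇔-trans (T-allFin _) (Π-cong-⇔ (λ j → T-does (a j ℚP.≟ a' j)))

ι-mkℚ : ∀ z → ι z ≡ mkℚ z 0 (Coprimality.sym (Coprimality.1-coprimeTo ℤ.∣ z ∣))
ι-mkℚ (+ n)    = ℚP.normalize-coprime {n} {0} _
ι-mkℚ -[1+ n ] = cong ℚ.-_ (ℚP.normalize-coprime {suc n} {0} _)

↥-ι : ∀ z → ↥ ι z ≡ z
↥-ι z = cong ↥_ (ι-mkℚ z)

floor-ι : ∀ z → floor (ι z) ≡ z
floor-ι z rewrite ι-mkℚ z = trans (ℤD.div-pos-is-/ℕ z 1) (/ℕ1 z)
  where
  /ℕ1 : ∀ z → z ℤ./ℕ 1 ≡ z
  /ℕ1 (+ n)    = cong +_ (ℕD.n/1≡n n)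
  /ℕ1 -[1+ n ] rewrite ℕD.n%1≡0 (suc n) | ℕD.n/1≡n (suc n) = refl

T-isIntᵇ : ∀ q → T (isIntᵇ q) ⇔ IsInt q
T-isIntᵇ q = ⇔-trans (T-does (ι (floor q) ℚP.≟ q))
  (mk⇔ (λ ι⌊q⌋≡q → floor q , sym ι⌊q⌋≡q) (λ { (z , refl) → cong ι (floor-ι z) }))

<0⇔↥<0 : ∀ q → q ℚ.< 0ℚ ⇔ ↥ q ℤ.< 0ℤ
<0⇔↥<0 (mkℚ n _ _) = mk⇔ (λ { (ℚ.*<* n*1<0) → subst (ℤ._< 0ℤ) (ℤP.*-identityʳ n) n*1<0 })
                         (λ n<0 → ℚ.*<* (subst (ℤ._< 0ℤ) (sym (ℤP.*-identityʳ n)) n<0))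

0<⇔0<↥ : ∀ q → 0ℚ ℚ.< q ⇔ 0ℤ ℤ.< ↥ q
0<⇔0<↥ (mkℚ n _ _) = mk⇔ (λ { (ℚ.*<* 0<n*1) → subst (0ℤ ℤ.<_) (ℤP.*-identityʳ n) 0<n*1 })
                         (λ 0<n → ℚ.*<* (subst (0ℤ ℤ.<_) (sym (ℤP.*-identityʳ n)) 0<n))

0<-i⇔i<0 : ∀ {i} → 0ℤ ℤ.< ℤ.- i ⇔ i ℤ.< 0ℤ
0<-i⇔i<0 = mk⇔ ℤP.neg-cancel-< ℤP.neg-mono-<

-i<0⇔0<i : ∀ {i} → ℤ.- i ℤ.< 0ℤ ⇔ 0ℤ ℤ.< i
-i<0⇔0<i = mk⇔ ℤP.neg-cancel-< ℤP.neg-mono-<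

n/d<0⇔n<0 : ∀ n d → n ℤ./ + suc d ℤ.< 0ℤ ⇔ n ℤ.< 0ℤ
n/d<0⇔n<0 n d = mk⇔
  (λ n/d<0 → ℤP.≰⇒> (λ 0≤n → ℤP.<⇒≱ n/d<0 (ℤD.0≤n⇒0≤n/d n (+ suc d) 0≤n (ℤ.+≤+ ℕ.z≤n))))
  (λ n<0 → ℤP.≰⇒> (λ 0≤n/d → ℤP.<⇒≱ n<0
    (ℤP.≤-trans (ℤP.*-monoʳ-≤-nonNeg (+ suc d) 0≤n/d) (ℤD.[n/d]*d≤n n (+ suc d)))))

floor<0⇔<0 : ∀ q → floor q ℤ.< 0ℤ ⇔ q ℚ.< 0ℚ
floor<0⇔<0 q@(mkℚ n d _) = ⇔-trans (n/d<0⇔n<0 n d) (⇔-sym (<0⇔↥<0 q))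

ι-floor<0⇔<0 : ∀ q → ι (floor q) ℚ.< 0ℚ ⇔ q ℚ.< 0ℚ
ι-floor<0⇔<0 q = begin
  ι (floor q) ℚ.< 0ℚ   ∼⟨ <0⇔↥<0 (ι (floor q)) ⟩
  ↥ ι (floor q) ℤ.< 0ℤ ≡⟨ cong (ℤ._< 0ℤ) (↥-ι (floor q)) ⟩
  floor q ℤ.< 0ℤ       ∼⟨ floor<0⇔<0 q ⟩
  q ℚ.< 0ℚ             ∎
  where open EquationalReasoning

0<ι-ceiling⇔0< : ∀ q → 0ℚ ℚ.< ι (ceiling q) ⇔ 0ℚ ℚ.< q
0<ι-ceiling⇔0< q@record{} = begin
  0ℚ ℚ.< ι (ceiling q)     ∼⟨ 0<⇔0<↥ (ι (ceiling q)) ⟩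
  0ℤ ℤ.< ↥ ι (ceiling q)   ≡⟨ cong (0ℤ ℤ.<_) (↥-ι (ceiling q)) ⟩
  0ℤ ℤ.< ℤ.- floor (ℚ.- q) ∼⟨ 0<-i⇔i<0 ⟩
  floor (ℚ.- q) ℤ.< 0ℤ     ∼⟨ floor<0⇔<0 (ℚ.- q) ⟩
  ℚ.- q ℚ.< 0ℚ             ∼⟨ <0⇔↥<0 (ℚ.- q) ⟩
  ↥ (ℚ.- q) ℤ.< 0ℤ         ≡⟨ cong (ℤ._< 0ℤ) (ℚP.↥-neg q) ⟩
  ℤ.- ↥ q ℤ.< 0ℤ           ∼⟨ -i<0⇔0<i ⟩
  0ℤ ℤ.< ↥ q               ∼⟨ ⇔-sym (0<⇔0<↥ q) ⟩
  0ℚ ℚ.< q                 ∎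
  where open EquationalReasoning

0<ᵇ≡0<ᵇι-ceiling : ∀ q → (0ℚ <ℚ q) ≡ (0ℚ <ℚ ι (ceiling q))
0<ᵇ≡0<ᵇι-ceiling q = does-⇔ (⇔-sym (0<ι-ceiling⇔0< q)) (0ℚ ℚP.<? q) (0ℚ ℚP.<? ι (ceiling q))

<ᵇ0≡ι-floor<ᵇ0 : ∀ q → (q <ℚ 0ℚ) ≡ (ι (floor q) <ℚ 0ℚ)
<ᵇ0≡ι-floor<ᵇ0 q = does-⇔ (⇔-sym (ι-floor<0⇔<0 q)) (q ℚP.<? 0ℚ) (ι (floor q) ℚP.<? 0ℚ)

T-eqS : ∀ {s} → T (eqS s) ⇔ s ≡ eq
T-eqS {leq} = mk⇔ (λ ()) (λ ())
T-eqS {eq}  = mk⇔ (λ _ → refl) (λ _ → tt)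
T-eqS {geq} = mk⇔ (λ ()) (λ ())

T-geqS : ∀ {s} → T (geqS s) ⇔ (s ≡ eq ⊎ s ≡ geq)
T-geqS {leq} = mk⇔ (λ ()) (λ { (inj₁ ()) ; (inj₂ ()) })
T-geqS {eq}  = mk⇔ (λ _ → inj₁ refl) (λ _ → tt)
T-geqS {geq} = mk⇔ (λ _ → inj₂ refl) (λ _ → tt)

T-leqS : ∀ {s} → T (leqS s) ⇔ (s ≡ eq ⊎ s ≡ leq)
T-leqS {leq} = mk⇔ (λ _ → inj₂ refl) (λ _ → tt)
T-leqS {eq}  = mk⇔ (λ _ → inj₁ refl) (λ _ → tt)
T-leqS {geq} = mk⇔ (λ ()) (λ { (inj₁ ()) ; (inj₂ ()) })

data SignFlags : Bool → Bool → Bool → Set where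
  flagsOf   : ∀ s → SignFlags (eqS s) (geqS s) (leqS s)
  undefined : SignFlags false false false

signFlags : ∀ {e g l} → (T e → T g × T l) → (T g → T l → T e) → SignFlags e g l
signFlags {true}  {true}  {true}  _     _     = flagsOf eq
signFlags {false} {true}  {false} _     _     = flagsOf geq
signFlags {false} {false} {true}  _     _     = flagsOf leq
signFlags {false} {false} {false} _     _     = undefined
signFlags {true}  {false}         e⇒g×l _     = ⊥-elim (proj₁ (e⇒g×l tt))
signFlags {true}  {true}  {false} e⇒g×l _     = ⊥-elim (proj₂ (e⇒g×l tt))
signFlags {false} {true}  {true}  _     g⇒l⇒e = ⊥-elim (g⇒l⇒e tt tt)

fromSignFlags : ∀ {n} → (Fin n → ℚ) → ℚ → Bool → Bool → Bool → Maybe (Constraint n)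
fromSignFlags a b e g l =
  if e then just (mkCons a b eq) else if g then just (mkCons a b geq)
  else if l then just (mkCons a b leq) else nothing

module _ {n d : ℕ} (Cs : Fin d → Constraint n) (λ' : Fin d → ℚ) where

  T-nzᵇ : ∀ i → T (nzᵇ Cs λ' i) ⇔ λ' i ≢ 0ℚ
  T-nzᵇ i = T-not-does (λ' i ℚP.≟ 0ℚ)

  combination-signFlags : SignFlags (combEq Cs λ') (combGeq Cs λ') (combLeq Cs λ')
  combination-signFlags = signFlags
    (λ e → from ≥0 (λ i nz → ℚP.≤-reflexive (sym (to ≡0 e i nz)))
         , from ≤0 (λ i nz → ℚP.≤-reflexive (to ≡0 e i nz)))
    (λ g l → from ≡0 (λ i nz → ℚP.≤-antisym (to ≤0 l i nz) (to ≥0 g i nz)))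
    where
    term : Fin d → ℚ
    term i = λ' i ℚ.* sgnℚ (sign (Cs i))
    onSupport : {R : ℚ → Set} (R? : ∀ x → Dec (R x)) →
      T (allFin (λ i → nzᵇ Cs λ' i ⇒ᵇ does (R? (term i))))
      ⇔ (∀ i → T (nzᵇ Cs λ' i) → R (term i))
    onSupport R? = ⇔-trans (T-allFin-⇒ᵇ _ _)
      (Π-cong-⇔ (λ i → →-cong-⇔ (⇔-id _) (T-does (R? (term i)))))
    ≡0 : T (combEq Cs λ') ⇔ (∀ i → T (nzᵇ Cs λ' i) → term i ≡ 0ℚ)
    ≡0 = onSupport (ℚP._≟ 0ℚ)
    ≥0 : T (combGeq Cs λ') ⇔ (∀ i → T (nzᵇ Cs λ' i) → 0ℚ ℚ.≤ term i)
    ≥0 = onSupport (0ℚ ℚP.≤?_)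
    ≤0 : T (combLeq Cs λ') ⇔ (∀ i → T (nzᵇ Cs λ' i) → term i ℚ.≤ 0ℚ)
    ≤0 = onSupport (ℚP._≤? 0ℚ)

module _ {n : ℕ} where

  T-absurdity : (C : Constraint n) →
    T (vecEqᵇ (coef C) zeroVec
       ∧ (if eqS (sign C) then not (rhs C =ℚ 0ℚ) else if geqS (sign C) then 0ℚ <ℚ rhs C
          else if leqS (sign C) then rhs C <ℚ 0ℚ else false))
    ⇔ Absurdity C
  T-absurdity (mkCons a b leq) = T-vecEqᵇ a zeroVec ∧-⇔ T-does (b ℚP.<? 0ℚ)
  T-absurdity (mkCons a b eq)  = T-vecEqᵇ a zeroVec ∧-⇔ T-not-does (b ℚP.≟ 0ℚ)
  T-absurdity (mkCons a b geq) = T-vecEqᵇ a zeroVec ∧-⇔ T-does (0ℚ ℚP.<? b)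

  T-φDOMᶜ : (C C' : Constraint n) → T (φDOMᶜ C C') ⇔ Dominates C C'
  T-φDOMᶜ C (mkCons a' b' leq) =
    T-absurdity C ∨-⇔ T-vecEqᵇ (coef C) a' ∧-⇔ T-leqS ∧-⇔ T-does (rhs C ℚP.≤? b')
  T-φDOMᶜ C (mkCons a' b' eq)  =
    T-absurdity C ∨-⇔ T-vecEqᵇ (coef C) a' ∧-⇔ T-eqS ∧-⇔ T-does (rhs C ℚP.≟ b')
  T-φDOMᶜ C (mkCons a' b' geq) =
    T-absurdity C ∨-⇔ T-vecEqᵇ (coef C) a' ∧-⇔ T-geqS ∧-⇔ T-does (b' ℚP.≤? rhs C)

  T-φDOM-fromSignFlags : ∀ {e g l} → SignFlags e g l → ∀ a b (C' : Constraint n) →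
    T (φDOM a b e g l (coef C') (rhs C') (eqS (sign C')) (geqS (sign C')) (leqS (sign C')))
    ⇔ DominatesM (fromSignFlags a b e g l) C'
  T-φDOM-fromSignFlags (flagsOf leq) a b C' = T-φDOMᶜ (mkCons a b leq) C'
  T-φDOM-fromSignFlags (flagsOf eq)  a b C' = T-φDOMᶜ (mkCons a b eq) C'
  T-φDOM-fromSignFlags (flagsOf geq) a b C' = T-φDOMᶜ (mkCons a b geq) C'
  T-φDOM-fromSignFlags undefined a b (mkCons a' _ leq) =
    mk⇔ (¬T-∨-∧false (vecEqᵇ a zeroVec) (vecEqᵇ a a')) (λ ())
  T-φDOM-fromSignFlags undefined a b (mkCons a' _ eq) =
    mk⇔ (¬T-∨-∧false (vecEqᵇ a zeroVec) (vecEqᵇ a a')) (λ ())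
  T-φDOM-fromSignFlags undefined a b (mkCons a' _ geq) =
    mk⇔ (¬T-∨-∧false (vecEqᵇ a zeroVec) (vecEqᵇ a a')) (λ ())

  T-intOnIᵇ : (I : Fin n → Bool) (a : Fin n → ℚ) → T (intOnIᵇ I a) ⇔ IntOnIZeroOff I a
  T-intOnIᵇ I a = ⇔-trans (T-allFin _) (Π-cong-⇔ pointwise)
    where
    pointwise : ∀ j → T (if I j then isIntᵇ (a j) else a j =ℚ 0ℚ)
                      ⇔ ((T (I j) → IsInt (a j)) × (¬ T (I j) → a j ≡ 0ℚ))
    pointwise j with I j
    ... | true  = mk⇔ (λ int → (λ _ → to (T-isIntᵇ (a j)) int) , (λ ¬⊤ → ⊥-elim (¬⊤ tt)))
                      (λ (int , _) → from (T-isIntᵇ (a j)) (int tt))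
    ... | false = mk⇔ (λ aⱼ≡0 → (λ ()) , (λ _ → to (T-does (a j ℚP.≟ 0ℚ)) aⱼ≡0))
                      (λ (_ , aⱼ≡0) → from (T-does (a j ℚP.≟ 0ℚ)) (aⱼ≡0 (λ ())))

  T-φRND : (I : Fin n → Bool) (a : Fin n → ℚ) (b : ℚ) (s : Sign) →
    T (φRND I a b (eqS s)) ⇔ Roundable I (mkCons a b s)
  T-φRND I a b s = ⇔-trans (T-intOnIᵇ I a ∧-⇔ ⇔-trans T-not (¬-cong-⇔ (T-eqS {s}))) (mk⇔ swap swap)

  -- The rounding clause of φ_DER(k) for reason rnd, as it occurs in φDERₖ.
  roundingDomᵇ : Bool → Bool → (Fin n → ℚ) → ℚ → Constraint n → Bool
  roundingDomᵇ g l a b Ck =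
    (vecEqᵇ a zeroVec ∧ (if g then 0ℚ <ℚ b else if l then b <ℚ 0ℚ else false))
    ∨ (vecEqᵇ a (coef Ck) ∧
       (if sgnℤ (sign Ck) =ℤ + 0 then false
        else if sgnℤ (sign Ck) =ℤ + 1 then (g ∧ (rhs Ck ≤ℚ ι (ceiling b)))
        else (l ∧ (ι (floor b) ≤ℚ rhs Ck))))

  RoundingDominates : (Fin n → Bool) → Maybe (Constraint n) → Constraint n → Set
  RoundingDominates I nothing  Ck = ⊥
  RoundingDominates I (just C) Ck = Roundable I C × Dominates (rounding I C) Ck

  -- Once the sign of Ck is known, the second disjuncts of both sides compute to the same Boolean.
  roundingDom-geq : ∀ a b Ck →
    roundingDomᵇ true false a b Ck ≡ φDOMᶜ (mkCons a (ι (ceiling b)) geq) Ck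
  roundingDom-geq a b (mkCons _ _ leq) = cong₂ _∨_ (cong (vecEqᵇ a zeroVec ∧_) (0<ᵇ≡0<ᵇι-ceiling b)) refl
  roundingDom-geq a b (mkCons _ _ eq)  = cong₂ _∨_ (cong (vecEqᵇ a zeroVec ∧_) (0<ᵇ≡0<ᵇι-ceiling b)) refl
  roundingDom-geq a b (mkCons _ _ geq) = cong₂ _∨_ (cong (vecEqᵇ a zeroVec ∧_) (0<ᵇ≡0<ᵇι-ceiling b)) refl

  roundingDom-leq : ∀ a b Ck →
    roundingDomᵇ false true a b Ck ≡ φDOMᶜ (mkCons a (ι (floor b)) leq) Ck
  roundingDom-leq a b (mkCons _ _ leq) = cong₂ _∨_ (cong (vecEqᵇ a zeroVec ∧_) (<ᵇ0≡ι-floor<ᵇ0 b)) refl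
  roundingDom-leq a b (mkCons _ _ eq)  = cong₂ _∨_ (cong (vecEqᵇ a zeroVec ∧_) (<ᵇ0≡ι-floor<ᵇ0 b)) refl
  roundingDom-leq a b (mkCons _ _ geq) = cong₂ _∨_ (cong (vecEqᵇ a zeroVec ∧_) (<ᵇ0≡ι-floor<ᵇ0 b)) refl

  T-rounding : ∀ {e g l} → SignFlags e g l → ∀ I a b (Ck : Constraint n) →
    T (φRND I a b e ∧ roundingDomᵇ g l a b Ck) ⇔ RoundingDominates I (fromSignFlags a b e g l) Ck
  T-rounding (flagsOf leq) I a b Ck = T-φRND I a b leq ∧-⇔
    subst (λ x → T x ⇔ Dominates (mkCons a (ι (floor b)) leq) Ck) (sym (roundingDom-leq a b Ck))
      (T-φDOMᶜ (mkCons a (ι (floor b)) leq) Ck)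
  T-rounding (flagsOf eq) I a b Ck =
    mk⇔ (⊥-elim ∘ notRoundable ∘ to (T-φRND I a b eq) ∘ proj₁ ∘ to T-∧)
        (⊥-elim ∘ notRoundable ∘ proj₁)
    where
    notRoundable : ¬ Roundable I (mkCons a b eq)
    notRoundable (eq≢eq , _) = eq≢eq refl
  T-rounding (flagsOf geq) I a b Ck = T-φRND I a b geq ∧-⇔
    subst (λ x → T x ⇔ Dominates (mkCons a (ι (ceiling b)) geq) Ck) (sym (roundingDom-geq a b Ck))
      (T-φDOMᶜ (mkCons a (ι (ceiling b)) geq) Ck)
  T-rounding undefined I a b (mkCons a' _ leq) =
    mk⇔ (¬T-∨-∧false (vecEqᵇ a zeroVec) (vecEqᵇ a a') ∘ proj₂ ∘ to T-∧) (λ ())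
  T-rounding undefined I a b (mkCons a' _ eq) =
    mk⇔ (¬T-∨-∧false (vecEqᵇ a zeroVec) (vecEqᵇ a a') ∘ proj₂ ∘ to T-∧) (λ ())
  T-rounding undefined I a b (mkCons a' _ geq) =
    mk⇔ (¬T-∨-∧false (vecEqᵇ a zeroVec) (vecEqᵇ a a') ∘ proj₂ ∘ to T-∧) (λ ())

SplitSigns : Sign → Sign → ℚ → ℚ → Set
SplitSigns s s' b b' =
  (s ≡ geq × s' ≡ leq × b ≡ b' ℚ.+ 1ℚ) ⊎ (s ≡ leq × s' ≡ geq × b ≡ b' ℚ.- 1ℚ)

T-splitSigns : ∀ s s' b b' →
  T (not (sgnℤ s =ℤ + 0) ∧ ((sgnℤ s ℤ.+ sgnℤ s') =ℤ + 0)
     ∧ (if sgnℤ s =ℤ + 1 then b =ℚ (b' ℚ.+ 1ℚ) else b =ℚ (b' ℚ.- 1ℚ)))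
  ⇔ SplitSigns s s' b b'
T-splitSigns geq leq b b' = mk⇔ (λ t → inj₁ (refl , refl , to (T-does (b ℚP.≟ b' ℚ.+ 1ℚ)) t))
  (λ { (inj₁ (_ , _ , b≡b'+1)) → from (T-does (b ℚP.≟ b' ℚ.+ 1ℚ)) b≡b'+1 ; (inj₂ (() , _)) })
T-splitSigns leq geq b b' = mk⇔ (λ t → inj₂ (refl , refl , to (T-does (b ℚP.≟ b' ℚ.- 1ℚ)) t))
  (λ { (inj₂ (_ , _ , b≡b'-1)) → from (T-does (b ℚP.≟ b' ℚ.- 1ℚ)) b≡b'-1 ; (inj₁ (() , _)) })
T-splitSigns leq leq b b' = mk⇔ (λ ()) (λ { (inj₁ (() , _)) ; (inj₂ (_ , () , _)) })
T-splitSigns geq geq b b' = mk⇔ (λ ()) (λ { (inj₁ (_ , () , _)) ; (inj₂ (() , _)) })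
T-splitSigns eq  s'  b b' = mk⇔ (λ ()) (λ { (inj₁ (() , _)) ; (inj₂ (() , _)) })
T-splitSigns leq eq  b b' = mk⇔ (λ ()) (λ { (inj₁ (() , _)) ; (inj₂ (_ , () , _)) })
T-splitSigns geq eq  b b' = mk⇔ (λ ()) (λ { (inj₁ (_ , () , _)) ; (inj₂ (() , _)) })

module _ (ip : MILP) (cert : Certificate ip) where

  isAsm-↑ʳ : ∀ k' → isAsm cert (m ip ↑ʳ k') ≡ isAsmR (reason cert k')
  isAsm-↑ʳ k' rewrite FinP.splitAt-↑ʳ (m ip) (nder cert) k' = refl

  A-↑ʳ : ∀ k' j → A cert (m ip ↑ʳ k') j ≡ asmSet cert k' j
  A-↑ʳ k' j rewrite FinP.splitAt-↑ʳ (m ip) (nder cert) k' = refl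

  A-original : ∀ {i i'} → splitAt (m ip) i ≡ inj₁ i' → ∀ j → ¬ T (A cert i j)
  A-original split j rewrite split = λ ()

  data IndexView : Fin (d cert) → Set where
    original  : ∀ i → (∀ j → ¬ T (A cert i j)) → IndexView i
    derivedAt : ∀ k' → IndexView (m ip ↑ʳ k')

  indexView : ∀ i → IndexView i
  indexView i with splitAt (m ip) i in split
  ... | inj₁ _  = original i (A-original split)
  ... | inj₂ k' = subst IndexView (FinP.splitAt⁻¹-↑ʳ split) (derivedAt k')

  A⊆S : ∀ i j → T (A cert i j) → T (isAsm cert j)
  A⊆S i j with indexView i
  ... | original _ ¬A = ⊥-elim ∘ ¬A j
  ... | derivedAt k'  = asm⊆S cert k' j ∘ subst T (A-↑ʳ k' j)

  AllS : (Fin (d cert) → Set) → (Fin (d cert) → Set) → Set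
  AllS R P = ∀ j → T (isAsm cert j) → R j → P j

  AllS-cong : ∀ {R P Q : Fin (d cert) → Set} → (∀ j → T (isAsm cert j) → R j → P j ⇔ Q j) →
    AllS R P ⇔ AllS R Q
  AllS-cong P⇔Q = mk⇔ (λ h j j∈S Rj → to (P⇔Q j j∈S Rj) (h j j∈S Rj))
                      (λ h j j∈S Rj → from (P⇔Q j j∈S Rj) (h j j∈S Rj))

  T-allS> : ∀ k f → T (allS> ip cert k f) ⇔ AllS (k <_) (T ∘ f)
  T-allS> k f = T-allFin-guarded (isAsm cert) (k <F_) f (T-<F k)

  T-allS< : ∀ k f → T (allS< ip cert k f) ⇔ AllS (_< k) (T ∘ f)
  T-allS< k f = T-allFin-guarded (isAsm cert) (_<F k) f (λ j → T-<F j k)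

  ∀-by-trichotomy-∉S : ∀ k {P : Fin (d cert) → Set} → ¬ T (isAsm cert k) →
    (∀ j → ¬ T (isAsm cert j) → P j) →
    (∀ j → P j) ⇔ (AllS (k <_) P × AllS (_< k) P)
  ∀-by-trichotomy-∉S k k∉S outside = ⇔-trans (∀-by-trichotomy (isAsm cert) k outside)
    (mk⇔ (λ (above , _ , below) → above , below)
         (λ (above , below) → above , outside k k∉S , below))

  T-φASM-asm : ∀ k → T (isAsm cert k) → T (φASM ip cert k asm) ⇔ (∀ j → A cert k j ≡ (j =F k))
  T-φASM-asm k k∈S = begin
    T (φASM ip cert k asm)
      ∼⟨ T-allS> k _ ∧-⇔ ⇔-id (T (A cert k k)) ∧-⇔ T-allS< k _ ⟩
    (AllS (k <_) (T ∘ not ∘ A cert k) × T (A cert k k) × AllS (_< k) (T ∘ not ∘ A cert k))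
      ∼⟨ AllS-cong (λ j _ k<j → offDiagonal j (FinP.<⇒≢ k<j ∘ sym)) ×-⇔ diagonal
         ×-⇔ AllS-cong (λ j _ j<k → offDiagonal j (FinP.<⇒≢ j<k)) ⟩
    (AllS (k <_) Claim × Claim k × AllS (_< k) Claim)
      ∼⟨ ⇔-sym (∀-by-trichotomy (isAsm cert) k outside) ⟩
    (∀ j → Claim j) ∎
    where
    open EquationalReasoning
    Claim : Fin (d cert) → Set
    Claim j = A cert k j ≡ (j =F k)
    offDiagonal : ∀ j → j ≢ k → T (not (A cert k j)) ⇔ Claim j
    offDiagonal j j≢k rewrite dec-false (j Fin.≟ k) j≢k = T-not-≡
    diagonal : T (A cert k k) ⇔ Claim k
    diagonal rewrite dec-true (k Fin.≟ k) refl = T-≡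
    outside : ∀ j → ¬ T (isAsm cert j) → Claim j
    outside j j∉S = trans (to T-not-≡ (from T-not (j∉S ∘ A⊆S k j)))
                          (sym (dec-false (j Fin.≟ k) (λ { refl → j∉S k∈S })))

  T-φASM-inherited : ∀ k (Sem : Fin (d cert) → Set) (b : Fin (d cert) → Bool) →
    ¬ T (isAsm cert k) →
    (∀ j → T (b j) ⇔ Sem j) → (∀ j → Sem j → T (isAsm cert j) × j < k) →
    T (allS> ip cert k (λ j → not (A cert k j)) ∧ allS< ip cert k (λ j → A cert k j ==ᵇ b j))
    ⇔ (∀ j → T (A cert k j) ⇔ Sem j)
  T-φASM-inherited k Sem b k∉S b⇔Sem Sem⊆ = begin
    T (allS> ip cert k (λ j → not (A cert k j)) ∧ allS< ip cert k (λ j → A cert k j ==ᵇ b j))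
      ∼⟨ T-allS> k _ ∧-⇔ T-allS< k _ ⟩
    (AllS (k <_) (T ∘ not ∘ A cert k) × AllS (_< k) (λ j → T (A cert k j ==ᵇ b j)))
      ∼⟨ AllS-cong above ×-⇔ AllS-cong (λ j _ _ → ⇔-trans T-==ᵇ (Related-cong (⇔-id _) (b⇔Sem j)))
      ⟩
    (AllS (k <_) Claim × AllS (_< k) Claim)
      ∼⟨ ⇔-sym (∀-by-trichotomy-∉S k k∉S outside) ⟩
    (∀ j → Claim j) ∎
    where
    open EquationalReasoning
    Claim : Fin (d cert) → Set
    Claim j = T (A cert k j) ⇔ Sem j
    above : ∀ j → T (isAsm cert j) → k < j → T (not (A cert k j)) ⇔ Claim j
    above j _ k<j = mk⇔
      (λ ¬a → mk⇔ (⊥-elim ∘ to T-not ¬a) (λ s → ⊥-elim (FinP.<-asym k<j (proj₂ (Sem⊆ j s)))))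
      (λ a⇔s → from T-not (λ a → FinP.<-asym k<j (proj₂ (Sem⊆ j (to a⇔s a)))))
    outside : ∀ j → ¬ T (isAsm cert j) → Claim j
    outside j j∉S = mk⇔ (⊥-elim ∘ j∉S ∘ A⊆S k j) (⊥-elim ∘ j∉S ∘ proj₁ ∘ Sem⊆ j)

  T-φASM-sol : ∀ k → ¬ T (isAsm cert k) → T (φASM ip cert k sol) ⇔ (∀ j → ¬ T (A cert k j))
  T-φASM-sol k k∉S = begin
    T (φASM ip cert k sol)
      ∼⟨ T-allS> k _ ∧-⇔ T-allS< k _ ⟩
    (AllS (k <_) (T ∘ not ∘ A cert k) × AllS (_< k) (T ∘ not ∘ A cert k))
      ∼⟨ AllS-cong (λ _ _ _ → T-not) ×-⇔ AllS-cong (λ _ _ _ → T-not) ⟩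
    (AllS (k <_) (¬_ ∘ T ∘ A cert k) × AllS (_< k) (¬_ ∘ T ∘ A cert k))
      ∼⟨ ⇔-sym (∀-by-trichotomy-∉S k k∉S (λ j j∉S → j∉S ∘ A⊆S k j)) ⟩
    (∀ j → ¬ T (A cert k j)) ∎
    where open EquationalReasoning

  AssumptionsPrecede : Set
  AssumptionsPrecede = ∀ i j → T (A cert i j) → j ≤ i

  φASM⇒precede : ∀ k r → T (φASM ip cert k r) → ∀ j → T (A cert k j) → j ≤ k
  φASM⇒precede k r t j a =
    ℕP.≮⇒≥ (λ k<j → to T-not (to (T-allS> k _) (proj₁ (to T-∧ t)) j (A⊆S k j a) k<j) a)

  φDERₖ⇒φASM : ∀ k r → T (φDERₖ ip cert k r) → T (φASM ip cert k r)
  φDERₖ⇒φASM k asm               = λ t → t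
  φDERₖ⇒φASM k (lin λ')          = proj₁ ∘ to T-∧
  φDERₖ⇒φASM k (rnd λ')          = proj₁ ∘ to T-∧
  φDERₖ⇒φASM k (uns i₁ l₁ i₂ l₂) = proj₁ ∘ to T-∧
  φDERₖ⇒φASM k sol               = proj₁ ∘ to T-∧

  φDER⇒precede : T (allFin (λ k' → φDERₖ ip cert (m ip ↑ʳ k') (reason cert k'))) →
    AssumptionsPrecede
  φDER⇒precede t i j a with indexView i
  ... | original _ ¬A = ⊥-elim (¬A j a)
  ... | derivedAt k'  =
    φASM⇒precede _ (reason cert k') (φDERₖ⇒φASM _ (reason cert k') (to (T-allFin _) t k')) j a

  valid⇒precede-step : ∀ {k} r → ValidReason ip cert k r →
    (∀ i → i < k → ∀ j → T (A cert i j) → j ≤ i) → ∀ j → T (A cert k j) → j ≤ k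
  valid⇒precede-step asm A≡ _ j a =
    FinP.≤-reflexive (to (T-does (j Fin.≟ _)) (subst T (A≡ j) a))
  valid⇒precede-step (lin λ') (prv , A⇔ , _) ih j a with to (A⇔ j) a
  ... | i , λᵢ≢0 , aᵢ = FinP.≤-trans (ih i (prv i λᵢ≢0) j aᵢ) (ℕP.<⇒≤ (prv i λᵢ≢0))
  valid⇒precede-step (rnd λ') (prv , A⇔ , _) ih j a with to (A⇔ j) a
  ... | i , λᵢ≢0 , aᵢ = FinP.≤-trans (ih i (prv i λᵢ≢0) j aᵢ) (ℕP.<⇒≤ (prv i λᵢ≢0))
  valid⇒precede-step (uns i₁ l₁ i₂ l₂) (i₁<k , _ , i₂<k , _ , _ , _ , _ , A⇔) ih j a
    with to (A⇔ j) a
  ... | inj₁ (a₁ , _) = FinP.≤-trans (ih i₁ i₁<k j a₁) (ℕP.<⇒≤ i₁<k)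
  ... | inj₂ (a₂ , _) = FinP.≤-trans (ih i₂ i₂<k j a₂) (ℕP.<⇒≤ i₂<k)
  valid⇒precede-step sol (¬A , _) _ j a = ⊥-elim (¬A j a)

  valid⇒precede : (∀ k' → ValidReason ip cert (m ip ↑ʳ k') (reason cert k')) → AssumptionsPrecede
  valid⇒precede valid i = go i (FinInd.<-wellFounded i)
    where
    go : ∀ i → Acc _<_ i → ∀ j → T (A cert i j) → j ≤ i
    go i (acc rec) with indexView i
    ... | original _ ¬A = λ j a → ⊥-elim (¬A j a)
    ... | derivedAt k'  =
      valid⇒precede-step (reason cert k') (valid k') (λ i' i'<k → go i' (rec i'<k))

  T-φPRV : ∀ k λ' → T (φPRV ip cert k λ') ⇔ (∀ i → λ' i ≢ 0ℚ → i < k)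
  T-φPRV k λ' = ⇔-trans (T-allFin-⇒ᵇ _ _) (Π-cong-⇔ λ i →
    →-cong-⇔ (T-nzᵇ (C cert) λ' i) (T-<F i k))

  T-φASM-lin : ∀ k λ' → ¬ T (isAsm cert k) → AssumptionsPrecede → (∀ i → λ' i ≢ 0ℚ → i < k) →
    T (φASM ip cert k (lin λ')) ⇔ (∀ j → T (A cert k j) ⇔ ∃ (λ i → λ' i ≢ 0ℚ × T (A cert i j)))
  T-φASM-lin k λ' k∉S precede prv = T-φASM-inherited k _ _ k∉S
    (λ j → ⇔-trans (T-anyFin _) (∃-cong-⇔ λ i →
      ⇔-trans (T-nzᵇ (C cert) λ' i ∧-⇔ T-≤F j i ∧-⇔ T-<F i k ∧-⇔ ⇔-id (T (A cert i j)))
        (mk⇔ (λ (λᵢ≢0 , _ , _ , aᵢ) → λᵢ≢0 , aᵢ)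
             (λ (λᵢ≢0 , aᵢ) → λᵢ≢0 , precede i j aᵢ , prv i λᵢ≢0 , aᵢ))))
    (λ j (i , λᵢ≢0 , aᵢ) → A⊆S i j aᵢ , ℕP.≤-<-trans (precede i j aᵢ) (prv i λᵢ≢0))

  T-φASM-uns : ∀ k i₁ l₁ i₂ l₂ → ¬ T (isAsm cert k) → AssumptionsPrecede → i₁ < k → i₂ < k →
    T (φASM ip cert k (uns i₁ l₁ i₂ l₂))
    ⇔ (∀ j → T (A cert k j) ⇔ ((T (A cert i₁ j) × j ≢ l₁) ⊎ (T (A cert i₂ j) × j ≢ l₂)))
  T-φASM-uns k i₁ l₁ i₂ l₂ k∉S precede i₁<k i₂<k = T-φASM-inherited k _ _ k∉S
    (λ j → (⇔-id (T (A cert i₁ j)) ∧-⇔ T-not-does (j Fin.≟ l₁))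
           ∨-⇔ (⇔-id (T (A cert i₂ j)) ∧-⇔ T-not-does (j Fin.≟ l₂)))
    (λ { j (inj₁ (a₁ , _)) → A⊆S i₁ j a₁ , ℕP.≤-<-trans (precede i₁ j a₁) i₁<k
       ; j (inj₂ (a₂ , _)) → A⊆S i₂ j a₂ , ℕP.≤-<-trans (precede i₂ j a₂) i₂<k })

  T-φDIS : ∀ i j → T (φDIS ip cert i j) ⇔ SplitDisj (intVar ip) (C cert i) (C cert j)
  T-φDIS i j = T-vecEqᵇ _ _ ∧-⇔ T-intOnIᵇ _ _ ∧-⇔ T-isIntᵇ _ ∧-⇔ T-isIntᵇ _
               ∧-⇔ T-splitSigns (sign (C cert i)) (sign (C cert j)) (rhs (C cert i)) (rhs (C cert j))

  T-φRND-combination : ∀ k λ' →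
    T (φRND (intVar ip) (combCoef (C cert) λ') (combRhs (C cert) λ') (combEq (C cert) λ')
       ∧ roundingDomᵇ (combGeq (C cert) λ') (combLeq (C cert) λ')
                      (combCoef (C cert) λ') (combRhs (C cert) λ') (C cert k))
    ⇔ RoundingDominates (intVar ip) (combination (C cert) λ') (C cert k)
  T-φRND-combination k λ' = T-rounding (combination-signFlags (C cert) λ') (intVar ip) _ _ (C cert k)

  T-solDominates : ∀ k →
    T (if P ip cert then anyList (λ s → φDOMᶜ (objLe ip cert s) (C cert k)) (SOL cert)
       else anyList (λ s → φDOMᶜ (objGe ip cert s) (C cert k)) (SOL cert))
    ⇔ Any (λ s → Dominates (solCons ip s) (C cert k)) (SOL cert)
  T-solDominates k with sense ip
  ... | min = T-anyList _ (λ s → T-φDOMᶜ _ (C cert k)) (SOL cert)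
  ... | max = T-anyList _ (λ s → T-φDOMᶜ _ (C cert k)) (SOL cert)

  T-φDERₖ-combination : ∀ k λ' {x} {X : Set} → ¬ T (isAsm cert k) → AssumptionsPrecede → T x ⇔ X →
    T (φASM ip cert k (lin λ') ∧ φPRV ip cert k λ' ∧ x)
    ⇔ ((∀ i → λ' i ≢ 0ℚ → i < k)
       × (∀ j → T (A cert k j) ⇔ ∃ (λ i → λ' i ≢ 0ℚ × T (A cert i j)))
       × X)
  T-φDERₖ-combination k λ' k∉S precede x⇔X = ⇔-trans
    (T-∧-dependent (T-φPRV k λ' ∧-⇔ x⇔X) (λ (prv , _) → T-φASM-lin k λ' k∉S precede prv))
    (mk⇔ (λ (a , p , x) → p , a , x) (λ (p , a , x) → a , p , x))

  T-φDERₖ : ∀ k r → isAsm cert k ≡ isAsmR r → AssumptionsPrecede →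
    T (φDERₖ ip cert k r) ⇔ ValidReason ip cert k r
  T-φDERₖ k asm k∈S _ = T-φASM-asm k (subst T (sym k∈S) tt)
  T-φDERₖ k (lin λ') k∉S precede =
    T-φDERₖ-combination k λ' (subst T k∉S) precede
      (T-φDOM-fromSignFlags (combination-signFlags (C cert) λ') _ _ (C cert k))
  -- Splitting on the combination lets the rounding clause of ValidReason compute.
  T-φDERₖ k (rnd λ') k∉S precede with combination (C cert) λ' | T-φRND-combination k λ'
  ... | nothing | rounding⇔ = T-φDERₖ-combination k λ' (subst T k∉S) precede rounding⇔
  ... | just _  | rounding⇔ = T-φDERₖ-combination k λ' (subst T k∉S) precede rounding⇔
  T-φDERₖ k (uns i₁ l₁ i₂ l₂) k∉S precede = ⇔-trans
    (T-∧-dependent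
      (T-<F i₁ k ∧-⇔ T-<F i₂ k ∧-⇔ T-<F l₁ k ∧-⇔ T-<F l₂ k
       ∧-⇔ T-φDOMᶜ (C cert i₁) (C cert k) ∧-⇔ T-φDOMᶜ (C cert i₂) (C cert k) ∧-⇔ T-φDIS l₁ l₂)
      (λ (i₁<k , i₂<k , _) → T-φASM-uns k i₁ l₁ i₂ l₂ (subst T k∉S) precede i₁<k i₂<k))
    (mk⇔ (λ (a , i₁<k , i₂<k , l₁<k , l₂<k , d₁ , d₂ , sp) →
            i₁<k , l₁<k , i₂<k , l₂<k , d₁ , d₂ , sp , a)
         (λ (i₁<k , l₁<k , i₂<k , l₂<k , d₁ , d₂ , sp , a) →
            a , i₁<k , i₂<k , l₁<k , l₂<k , d₁ , d₂ , sp))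
  T-φDERₖ k sol k∉S _ = T-φASM-sol k (subst T k∉S) ∧-⇔ T-solDominates k

  T-lastᵇ : ∀ Q → T (lastᵇ ip cert Q) ⇔ LastOK ip cert Q
  T-lastᵇ Q with lastIdx (d cert)
  ... | nothing = mk⇔ (λ ()) (λ ())
  ... | just l  = T-φDOMᶜ (C cert l) Q ∧-⇔ ⇔-trans (T-allFin-⇒ᵇ _ _)
    (mk⇔ (λ h j a → to T-not (h j (A⊆S l j a)) a) (λ ¬A j _ → from T-not (¬A j)))

  T-φDER-final :
    T (if not (R ip cert) then lastᵇ ip cert falseCons
       else (((P ip cert ∧ PLB ip cert) ⇒ᵇ lastᵇ ip cert (mkCons (obj ip) (L ip cert) geq))
             ∧ ((not (P ip cert) ∧ PUB ip cert) ⇒ᵇ lastᵇ ip cert (mkCons (obj ip) (U ip cert) leq))))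
    ⇔ FinalOK ip cert (rtp cert) (sense ip)
  T-φDER-final with rtp cert | sense ip
  ... | infeasible               | _   = T-lastᵇ falseCons
  ... | bounds (just _) _        | min = ⇔-trans (T-lastᵇ _ ∧-⇔ ⇔-id _) (mk⇔ proj₁ (_, tt))
  ... | bounds nothing _         | min = ⇔-id _
  ... | bounds (just _) (just _) | max = T-lastᵇ _
  ... | bounds nothing  (just _) | max = T-lastᵇ _
  ... | bounds (just _) nothing  | max = ⇔-id _
  ... | bounds nothing  nothing  | max = ⇔-id _

  T-φDER : T (φDER ip cert) ⇔ DERValid ip cert
  T-φDER =
    mk⇔ (λ t → to (reasons⇔ (φDER⇒precede t)) t)
        (λ valid → from (reasons⇔ (valid⇒precede valid)) valid)
    ∧-⇔ T-φDER-final
    where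
    reasons⇔ : AssumptionsPrecede →
      T (allFin (λ k' → φDERₖ ip cert (m ip ↑ʳ k') (reason cert k')))
      ⇔ (∀ k' → ValidReason ip cert (m ip ↑ʳ k') (reason cert k'))
    reasons⇔ precede = ⇔-trans (T-allFin _) (Π-cong-⇔ λ k' →
      T-φDERₖ (m ip ↑ʳ k') (reason cert k') (isAsm-↑ʳ k') precede)

lemma13 : (ip : MILP) (cert : Certificate ip) →
            DERValid ip cert ⇔ (φDER ip cert ≡ true)
lemma13 ip cert = ⇔-trans (⇔-sym (T-φDER ip cert)) T-≡
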